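{- Let $w\in S_\infty$ and let $s_i$ be an elementary transposition with $l(ws_i)=l(w)-1$. Let $D\in\mathcal{P}(w)$. If $\mathrm{mitosis}_i(D)$ is nonempty, then either $\mathrm{mitosis}_i(D)\subseteq\mathcal{P}(ws_i)$ or $\mathrm{mitosis}_i(D)\subseteq\mathcal{P}(w)$.
   Context: $S_\infty=\bigcup_n S_n$, generated by $s_k=(k,k+1)$; $l(u)$ is the Coxeter length. A pipe dream is a finite subset $D\subset\mathbb{Z}_{>0}\times\mathbb{Z}_{>0}$ (elements $(r,c)$, row $r$, column $c$, are called crosses); the antidiagonal index of $(r,c)$ is $r+c-1$. The word of $D$ is the sequence of antidiagonal indices of its crosses read row by row from top to bottom, each row from right to left. The Demazure product of a word $(a_1,\dots,a_k)$: start with $u=\mathrm{id}$, and for $t=1,\dots,k$ replace $u$ by $us_{a_t}$ if $l(us_{a_t})=l(u)+1$, otherwise keep $u$. $\mathcal{P}(w)$ is the set of pipe dreams whose word has Demazure product $w$. Mitosis. For a pipe dream $D$ let $\mathrm{start}_i(D)=\min\{j:(i,j)\notin D\}$, and let $\mathcal{J}_i(D)=\{j<\mathrm{start}_i(D):(i+1,j)\notin D\}$. For $p\in\mathcal{J}_i(D)$, $D_p$ is obtained from $D$ by deleting the cross $(i,p)$ and then, for every $j\in\mathcal{J}_i(D)$ with $j<p$, moving the cross $(i,j)$ down to the empty box $(i+1,j)$. Then $\mathrm{mitosis}_i(D)=\{D_p: p\in\mathcal{J}_i(D)\}$ (empty if $\mathcal{J}_i(D)=\emptyset$). -}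

module Defs where

open import Data.Nat using (ℕ; zero; suc; _+_; _∸_; _≤_; _<_; _⊔_; _≡ᵇ_; _<ᵇ_)
open import Data.Bool using (Bool; true; false; if_then_else_; _∧_; not)
open import Data.List using (List; []; _∷_; _++_; foldl; foldr; concatMap; map)
open import Data.Nat.ListAction using (sum)
open import Data.Sum using (_⊎_)
open import Data.Product using (_×_)
open import Relation.Nullary.Decidable using (⌊_⌋)
open import Relation.Binary.PropositionalEquality using (_≡_)

-- Positive integers are modelled inside ℕ; position 0 is never moved.
-- A permutation of S_∞ (of the positive integers, finite support).
record Perm : Set where
  field
    fun    : ℕ → ℕ
    inv    : ℕ → ℕ
    bound  : ℕ
    inv-fun : ∀ x → inv (fun x) ≡ x
    fun-inv : ∀ x → fun (inv x) ≡ x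
    fixed  : ∀ x → (x ≡ 0 ⊎ bound ≤ x) → fun x ≡ x
open Perm public

s : ℕ → ℕ → ℕ
s k x = if x ≡ᵇ k then suc k else (if x ≡ᵇ suc k then k else x)

range1 : ℕ → List ℕ
range1 zero    = []
range1 (suc n) = range1 n ++ (suc n ∷ [])

revRange1 : ℕ → List ℕ
revRange1 zero    = []
revRange1 (suc n) = suc n ∷ revRange1 n

b2n : Bool → ℕ
b2n true  = 1
b2n false = 0

-- number of inversions of f among positions 1..N:
-- pairs 1 ≤ a < b ≤ N with f b < f a.  For a permutation supported in
-- [1, N] this is its Coxeter length l.
invs : ℕ → (ℕ → ℕ) → ℕ
invs N f = sum (concatMap (λ a → map (λ b → b2n ((a <ᵇ b) ∧ (f b <ᵇ f a))) (range1 N)) (range1 N))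

demStep : ℕ → (ℕ → ℕ) → ℕ → (ℕ → ℕ)
demStep N u a = if invs N (λ x → u (s a x)) ≡ᵇ suc (invs N u) then (λ x → u (s a x)) else u

maxList : List ℕ → ℕ
maxList = foldr _⊔_ 0

-- Demazure product of a word (all prefixes live in S_N, N = 1 + max letter)
demazure : List ℕ → (ℕ → ℕ)
demazure w = foldl (demStep (suc (maxList w))) (λ x → x) w

-- A pipe dream is given by its indicator D r c (row r, column c, both ≥ 1),
-- together with a bound B such that all crosses lie in [1,B] × [1,B].
PipeDream : Set
PipeDream = ℕ → ℕ → Bool

FiniteIn : PipeDream → ℕ → Set
FiniteIn D B = ∀ r c → D r c ≡ true → (1 ≤ r × r ≤ B) × (1 ≤ c × c ≤ B)

word : PipeDream → ℕ → List ℕ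
word D B = concatMap (λ r → concatMap (λ c → if D r c then ((r + c) ∸ 1 ∷ []) else []) (revRange1 B)) (range1 B)

InP : PipeDream → ℕ → (ℕ → ℕ) → Set
InP D B w = ∀ x → demazure (word D B) x ≡ w x

firstFalse : (ℕ → Bool) → ℕ → ℕ → ℕ
firstFalse f j zero    = j
firstFalse f j (suc k) = if f j then firstFalse f (suc j) k else j

start : PipeDream → ℕ → ℕ → ℕ
start D B i = firstFalse (D i) 1 (suc B)

inJ : PipeDream → ℕ → ℕ → ℕ → Bool
inJ D B i j = (1 ≤ᵇ' j) ∧ ((j <ᵇ start D B i) ∧ not (D (suc i) j))
  where
  _≤ᵇ'_ : ℕ → ℕ → Bool
  a ≤ᵇ' b = a <ᵇ suc b

mitosisPD : PipeDream → ℕ → ℕ → ℕ → PipeDream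
mitosisPD D B i p r c =
  if r ≡ᵇ i
  then (if c ≡ᵇ p then false else (if inJ D B i c ∧ (c <ᵇ p) then false else D r c))
  else (if r ≡ᵇ suc i
        then (if inJ D B i c ∧ (c <ᵇ p) then true else D r c)
        else D r c)

{-# OPTIONS --safe #-}

-- The Demazure product of a word is its 0-Hecke action on the identity: counting inversions
-- shows that u ↦ u s_a raises the length exactly when u a < u (a + 1), so a Demazure step sorts
-- the values at a, a + 1 into decreasing order.  Hence braid and commutation moves preserve
-- Demazure products.  Read rows i and i + 1 of D column by column.  For p ∈ 𝒥_i(D), row i is full
-- up to column p and (i + 1, p) is empty, so braid moves slide the letter of (i, p) through the
-- columns left of p, exchanging the two rows there, until it leaves as the letter i; what remains
-- is the block of D_p, and i commutes past the rows below.  Thus Dem(D) = Dem(D_p) ⋆ s_i, and the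
-- same slide shows that all D_p share one Demazure product v.  Finally w = v ⋆ s_i is v s_i or v,
-- so v = w s_i or v = w.

module Submission where

open import Defs
open import Data.Bool using (Bool; true; false; if_then_else_; _∧_; not; T)
open import Data.Bool.Properties using (∧-zeroʳ)
open import Data.Empty using (⊥-elim)
open import Data.List using (List; []; _∷_; _++_; [_]; foldl; concat; concatMap; map)
open import Data.List.Properties
  using (foldl-++; ++-assoc; ++-identityʳ; map-++; map-cong; map-cong-local; concatMap-++)
open import Data.List.Relation.Unary.All as All using (All; []; _∷_)
open import Data.List.Relation.Unary.All.Properties using (++⁺; concat⁺) renaming (map⁺ to All-map⁺)
open import Data.Nat
open import Data.Nat.ListAction using (sum)
open import Data.Nat.ListAction.Properties using (sum-++)
open import Data.Nat.Properties
open import Algebra.Properties.CommutativeSemigroup +-commutativeSemigroup using (interchange; xy∙z≈xz∙y)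
open import Data.Product using (_×_; _,_; ∃; proj₁; proj₂) renaming (map to ×-map; zip to ×-zip)
open import Data.Sum using (_⊎_; inj₁; inj₂)
import Data.Sum as Sum
open import Function using (_∘_; id)
open import Relation.Binary using (Setoid)
open import Relation.Binary.Definitions using (tri<; tri≈; tri>)
import Relation.Binary.Reasoning.Setoid
open import Relation.Binary.PropositionalEquality hiding ([_])
open import Relation.Nullary using (yes; no)
open import Relation.Nullary.Decidable using (dec-true; dec-false)

≡ᵇ-refl : ∀ n → (n ≡ᵇ n) ≡ true
≡ᵇ-refl n = dec-true (n ≟ n) refl

≢⇒≡ᵇ-false : ∀ {m n} → m ≢ n → (m ≡ᵇ n) ≡ false
≢⇒≡ᵇ-false {m} {n} = dec-false (m ≟ n)

<⇒<ᵇ-true : ∀ {m n} → m < n → (m <ᵇ n) ≡ true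
<⇒<ᵇ-true {m} {n} = dec-true (m <? n)

≥⇒<ᵇ-false : ∀ {m n} → n ≤ m → (m <ᵇ n) ≡ false
≥⇒<ᵇ-false {m} {n} n≤m = dec-false (m <? n) (≤⇒≯ n≤m)

<ᵇ-true⇒< : ∀ {m n} → (m <ᵇ n) ≡ true → m < n
<ᵇ-true⇒< {m} {n} e = <ᵇ⇒< m n (subst T (sym e) _)

<ᵇ-irrefl : ∀ n → (n <ᵇ n) ≡ false
<ᵇ-irrefl n = ≥⇒<ᵇ-false (≤-refl {n})

n<ᵇ1+n : ∀ n → (n <ᵇ suc n) ≡ true
n<ᵇ1+n n = <⇒<ᵇ-true (n<1+n n)

1+n<ᵇn : ∀ n → (suc n <ᵇ n) ≡ false
1+n<ᵇn n = ≥⇒<ᵇ-false (n≤1+n n)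

n≢1+n : ∀ n → n ≢ suc n
n≢1+n n = ≢-sym 1+n≢n

s-at : ∀ k → s k k ≡ suc k
s-at k rewrite ≡ᵇ-refl k = refl

s-at-suc : ∀ k → s k (suc k) ≡ k
s-at-suc k rewrite ≢⇒≡ᵇ-false (1+n≢n {k}) | ≡ᵇ-refl k = refl

s-other : ∀ k {x} → x ≢ k → x ≢ suc k → s k x ≡ x
s-other k x≢k x≢1+k rewrite ≢⇒≡ᵇ-false x≢k | ≢⇒≡ᵇ-false x≢1+k = refl

s-involutive : ∀ k x → s k (s k x) ≡ x
s-involutive k x with x ≟ k | x ≟ suc k
... | yes refl | _        rewrite s-at x = s-at-suc x
... | no _     | yes refl rewrite s-at-suc k = s-at k
... | no x≢k   | no x≢1+k rewrite s-other k x≢k x≢1+k = s-other k x≢k x≢1+k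

-- The 0-Hecke action and braid moves

sortAt : (ℕ → ℕ) → ℕ → ℕ → ℕ
sortAt g a x = if x ≡ᵇ a then g a ⊔ g (suc a) else (if x ≡ᵇ suc a then g a ⊓ g (suc a) else g x)

sortAt-at : ∀ g a → sortAt g a a ≡ g a ⊔ g (suc a)
sortAt-at g a rewrite ≡ᵇ-refl a = refl

sortAt-at-suc : ∀ g a → sortAt g a (suc a) ≡ g a ⊓ g (suc a)
sortAt-at-suc g a rewrite ≢⇒≡ᵇ-false (1+n≢n {a}) | ≡ᵇ-refl a = refl

sortAt-other : ∀ g a {x} → x ≢ a → x ≢ suc a → sortAt g a x ≡ g x
sortAt-other g a x≢a x≢1+a rewrite ≢⇒≡ᵇ-false x≢a | ≢⇒≡ᵇ-false x≢1+a = refl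

sortAt-below : ∀ g a → sortAt g (suc a) a ≡ g a
sortAt-below g a = sortAt-other g (suc a) (<⇒≢ (n<1+n a)) (<⇒≢ (m<n⇒m<1+n (n<1+n a)))

sortAt-above : ∀ g a → sortAt g a (suc (suc a)) ≡ g (suc (suc a))
sortAt-above g a = sortAt-other g a (>⇒≢ (m<n⇒m<1+n (n<1+n a))) (>⇒≢ (n<1+n (suc a)))

sortAt-cong : ∀ {g h} → g ≗ h → ∀ a → sortAt g a ≗ sortAt h a
sortAt-cong {g} {h} g≗h a x rewrite g≗h a | g≗h (suc a) | g≗h x = refl

sortAt-< : ∀ g a → g a < g (suc a) → sortAt g a ≗ g ∘ s a
sortAt-< g a lt x with x ≟ a | x ≟ suc a
... | yes refl | _        rewrite s-at x | sortAt-at g x = m≤n⇒m⊔n≡n (<⇒≤ lt)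
... | no _     | yes refl rewrite s-at-suc a | sortAt-at-suc g a = m≤n⇒m⊓n≡m (<⇒≤ lt)
... | no x≢a   | no x≢1+a rewrite s-other a x≢a x≢1+a = sortAt-other g a x≢a x≢1+a

sortAt-≥ : ∀ g a → g (suc a) ≤ g a → sortAt g a ≗ g
sortAt-≥ g a ge x with x ≟ a | x ≟ suc a
... | yes refl | _        rewrite sortAt-at g x = m≥n⇒m⊔n≡m ge
... | no _     | yes refl rewrite sortAt-at-suc g a = m≥n⇒m⊓n≡n ge
... | no x≢a   | no x≢1+a = sortAt-other g a x≢a x≢1+a

sortAt-preimage : ∀ {u v} a → u ≗ sortAt v a → (v ≗ u ∘ s a) ⊎ (v ≗ u)
sortAt-preimage {u} {v} a u≗v⋆a with v a <? v (suc a)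
... | yes lt = inj₁ λ x → begin
  v x               ≡⟨ cong v (s-involutive a x) ⟨
  v (s a (s a x))   ≡⟨ sortAt-< v a lt (s a x) ⟨
  sortAt v a (s a x) ≡⟨ u≗v⋆a (s a x) ⟨
  u (s a x)         ∎
  where open ≡-Reasoning
... | no ≮ = inj₂ λ x → trans (sym (sortAt-≥ v a (≮⇒≥ ≮) x)) (sym (u≗v⋆a x))

act : (ℕ → ℕ) → List ℕ → ℕ → ℕ
act = foldl sortAt

act-cong : ∀ {g h} → g ≗ h → ∀ w → act g w ≗ act h w
act-cong g≗h []      = g≗h
act-cong g≗h (a ∷ w) = act-cong (sortAt-cong g≗h a) w

act-++ : ∀ f u v → act f (u ++ v) ≗ act (act f u) v
act-++ f u v x = cong (λ g → g x) (foldl-++ sortAt f u v)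

infix 4 _≈_
record _≈_ (u v : List ℕ) : Set where
  constructor same-act
  field act-≗ : ∀ f → act f u ≗ act f v
open _≈_ public

≈-setoid : Setoid _ _
≈-setoid = record
  { Carrier       = List ℕ
  ; _≈_           = _≈_
  ; isEquivalence = record
    { refl  = same-act λ _ _ → refl
    ; sym   = λ u≈v → same-act λ f x → sym (act-≗ u≈v f x)
    ; trans = λ u≈v v≈w → same-act λ f x → trans (act-≗ u≈v f x) (act-≗ v≈w f x)
    }
  }

module ≈-Reasoning = Relation.Binary.Reasoning.Setoid ≈-setoid

open Setoid ≈-setoid public using () renaming (refl to ≈-refl; sym to ≈-sym; trans to ≈-trans; reflexive to ≈-reflexive)

≈-++⁺ˡ : ∀ xs {u v} → u ≈ v → xs ++ u ≈ xs ++ v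
≈-++⁺ˡ []       u≈v = u≈v
≈-++⁺ˡ (a ∷ xs) u≈v = same-act λ f → act-≗ (≈-++⁺ˡ xs u≈v) (sortAt f a)

≈-++⁺ʳ : ∀ ys {u v} → u ≈ v → u ++ ys ≈ v ++ ys
≈-++⁺ʳ ys {u} {v} u≈v = same-act λ f x → begin
  act f (u ++ ys) x       ≡⟨ act-++ f u ys x ⟩
  act (act f u) ys x      ≡⟨ act-cong (act-≗ u≈v f) ys x ⟩
  act (act f v) ys x      ≡⟨ act-++ f v ys x ⟨
  act f (v ++ ys) x       ∎
  where open ≡-Reasoning

≈-∷⁺ : ∀ a {u v} → u ≈ v → a ∷ u ≈ a ∷ v
≈-∷⁺ a = ≈-++⁺ˡ [ a ]

⊔-⊓-absorbs-⊔ : ∀ u v → (u ⊔ v) ⊔ (u ⊓ v) ≡ u ⊔ v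
⊔-⊓-absorbs-⊔ zero    v       = ⊔-identityʳ v
⊔-⊓-absorbs-⊔ (suc u) zero    = refl
⊔-⊓-absorbs-⊔ (suc u) (suc v) = cong suc (⊔-⊓-absorbs-⊔ u v)

⊔-⊓-absorbs-⊓ : ∀ u v → (u ⊔ v) ⊓ (u ⊓ v) ≡ u ⊓ v
⊔-⊓-absorbs-⊓ zero    v       = ⊓-zeroʳ v
⊔-⊓-absorbs-⊓ (suc u) zero    = refl
⊔-⊓-absorbs-⊓ (suc u) (suc v) = cong suc (⊔-⊓-absorbs-⊓ u v)

braid-max : ∀ u v w → (u ⊔ v) ⊔ ((u ⊓ v) ⊔ w) ≡ u ⊔ (v ⊔ w)
braid-max zero    v       w       = refl
braid-max (suc u) zero    w       = refl
braid-max (suc u) (suc v) zero    = cong suc (⊔-⊓-absorbs-⊔ u v)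
braid-max (suc u) (suc v) (suc w) = cong suc (braid-max u v w)

braid-median : ∀ u v w → (u ⊔ v) ⊓ ((u ⊓ v) ⊔ w) ≡ (u ⊓ (v ⊔ w)) ⊔ (v ⊓ w)
braid-median zero    v       w       = refl
braid-median (suc u) zero    w       = sym (⊔-identityʳ _)
braid-median (suc u) (suc v) zero    = cong suc (⊔-⊓-absorbs-⊓ u v)
braid-median (suc u) (suc v) (suc w) = cong suc (braid-median u v w)

braid-min : ∀ u v w → (u ⊓ v) ⊓ w ≡ (u ⊓ (v ⊔ w)) ⊓ (v ⊓ w)
braid-min zero    v       w       = refl
braid-min (suc u) zero    w       = sym (⊓-zeroʳ _)
braid-min (suc u) (suc v) zero    = refl
braid-min (suc u) (suc v) (suc w) = cong suc (braid-min u v w)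

-- Both sides sort the values at a, a + 1, a + 2 into decreasing order.
braid : ∀ a → a ∷ suc a ∷ a ∷ [] ≈ suc a ∷ a ∷ suc a ∷ []
braid a = same-act go
  where
  go : ∀ f → act f (a ∷ suc a ∷ a ∷ []) ≗ act f (suc a ∷ a ∷ suc a ∷ [])
  go f x with x ≟ a | x ≟ suc a | x ≟ suc (suc a)
  ... | yes refl | _ | _
    rewrite sortAt-at (sortAt (sortAt f a) (suc a)) a
          | sortAt-below (sortAt f a) a | sortAt-at (sortAt f a) (suc a)
          | sortAt-at f a | sortAt-at-suc f a | sortAt-above f a
          | sortAt-below (sortAt (sortAt f (suc a)) a) a | sortAt-at (sortAt f (suc a)) a
          | sortAt-below f a | sortAt-at f (suc a)
    = braid-max (f a) (f (suc a)) (f (suc (suc a)))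
  ... | no _ | yes refl | _
    rewrite sortAt-at-suc (sortAt (sortAt f a) (suc a)) a
          | sortAt-below (sortAt f a) a | sortAt-at (sortAt f a) (suc a)
          | sortAt-at f a | sortAt-at-suc f a | sortAt-above f a
          | sortAt-at (sortAt (sortAt f (suc a)) a) (suc a) | sortAt-above (sortAt f (suc a)) a
          | sortAt-at-suc (sortAt f (suc a)) a | sortAt-below f a
          | sortAt-at f (suc a) | sortAt-at-suc f (suc a)
    = braid-median (f a) (f (suc a)) (f (suc (suc a)))
  ... | no _ | no _ | yes refl
    rewrite sortAt-above (sortAt (sortAt f a) (suc a)) a
          | sortAt-at-suc (sortAt f a) (suc a)
          | sortAt-at-suc f a | sortAt-above f a
          | sortAt-at-suc (sortAt (sortAt f (suc a)) a) (suc a) | sortAt-above (sortAt f (suc a)) a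
          | sortAt-at-suc (sortAt f (suc a)) a | sortAt-below f a
          | sortAt-at f (suc a) | sortAt-at-suc f (suc a)
    = braid-min (f a) (f (suc a)) (f (suc (suc a)))
  ... | no x≢a | no x≢1+a | no x≢2+a
    rewrite sortAt-other (sortAt (sortAt f a) (suc a)) a x≢a x≢1+a
          | sortAt-other (sortAt f a) (suc a) x≢1+a x≢2+a | sortAt-other f a x≢a x≢1+a
          | sortAt-other (sortAt (sortAt f (suc a)) a) (suc a) x≢1+a x≢2+a
          | sortAt-other (sortAt f (suc a)) a x≢a x≢1+a | sortAt-other f (suc a) x≢1+a x≢2+a
    = refl

Distant : ℕ → ℕ → Set
Distant a b = suc a < b ⊎ suc b < a

Distant-sym : ∀ {a b} → Distant a b → Distant b a
Distant-sym (inj₁ lt) = inj₂ lt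
Distant-sym (inj₂ lt) = inj₁ lt

commute-disjoint : ∀ {a b} → a ≢ b → a ≢ suc b → suc a ≢ b → a ∷ b ∷ [] ≈ b ∷ a ∷ []
commute-disjoint {a} {b} a≢b a≢1+b 1+a≢b = same-act go
  where
  go : ∀ f → act f (a ∷ b ∷ []) ≗ act f (b ∷ a ∷ [])
  go f x with x ≟ a | x ≟ suc a | x ≟ b | x ≟ suc b
  ... | yes refl | _ | _ | _
    rewrite sortAt-other (sortAt f a) b a≢b a≢1+b | sortAt-at f a | sortAt-at (sortAt f b) a
          | sortAt-other f b a≢b a≢1+b | sortAt-other f b 1+a≢b (a≢b ∘ suc-injective)
    = refl
  ... | no _ | yes refl | _ | _
    rewrite sortAt-other (sortAt f a) b 1+a≢b (a≢b ∘ suc-injective) | sortAt-at-suc f a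
          | sortAt-at-suc (sortAt f b) a | sortAt-other f b a≢b a≢1+b
          | sortAt-other f b 1+a≢b (a≢b ∘ suc-injective)
    = refl
  ... | no _ | no _ | yes refl | _
    rewrite sortAt-at (sortAt f a) b | sortAt-other (sortAt f b) a (≢-sym a≢b) (≢-sym 1+a≢b)
          | sortAt-at f b | sortAt-other f a (≢-sym a≢b) (≢-sym 1+a≢b)
          | sortAt-other f a (≢-sym a≢1+b) (≢-sym (a≢b ∘ suc-injective))
    = refl
  ... | no _ | no _ | no _ | yes refl
    rewrite sortAt-at-suc (sortAt f a) b
          | sortAt-other (sortAt f b) a (≢-sym a≢1+b) (≢-sym (a≢b ∘ suc-injective))
          | sortAt-at-suc f b | sortAt-other f a (≢-sym a≢b) (≢-sym 1+a≢b)
          | sortAt-other f a (≢-sym a≢1+b) (≢-sym (a≢b ∘ suc-injective))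
    = refl
  ... | no x≢a | no x≢1+a | no x≢b | no x≢1+b
    rewrite sortAt-other (sortAt f a) b x≢b x≢1+b | sortAt-other f a x≢a x≢1+a
          | sortAt-other (sortAt f b) a x≢a x≢1+a | sortAt-other f b x≢b x≢1+b
    = refl

commute : ∀ {a b} → Distant a b → a ∷ b ∷ [] ≈ b ∷ a ∷ []
commute (inj₁ 1+a<b) =
  commute-disjoint (<⇒≢ (<-trans (n<1+n _) 1+a<b)) (<⇒≢ (m<n⇒m<1+n (<-trans (n<1+n _) 1+a<b))) (<⇒≢ 1+a<b)
commute (inj₂ 1+b<a) = ≈-sym (commute (inj₁ 1+b<a))

commute-∷ʳ : ∀ b xs → All (Distant b) xs → xs ++ [ b ] ≈ b ∷ xs
commute-∷ʳ b []       []                     = ≈-refl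
commute-∷ʳ b (x ∷ xs) (b∼x ∷ distant) = begin
  x ∷ (xs ++ [ b ]) ≈⟨ ≈-∷⁺ x (commute-∷ʳ b xs distant) ⟩
  x ∷ b ∷ xs        ≈⟨ ≈-++⁺ʳ xs (commute (Distant-sym b∼x)) ⟩
  b ∷ x ∷ xs        ∎
  where open ≈-Reasoning

commute-++ : ∀ xs ys → All (λ y → All (Distant y) xs) ys → xs ++ ys ≈ ys ++ xs
commute-++ xs []       []                   = ≈-reflexive (++-identityʳ xs)
commute-++ xs (y ∷ ys) (distant ∷ distants) = begin
  xs ++ y ∷ ys        ≡⟨ ++-assoc xs [ y ] ys ⟨
  (xs ++ [ y ]) ++ ys ≈⟨ ≈-++⁺ʳ ys (commute-∷ʳ y xs distant) ⟩
  y ∷ xs ++ ys        ≈⟨ ≈-∷⁺ y (commute-++ xs ys distants) ⟩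
  y ∷ ys ++ xs        ∎
  where open ≈-Reasoning

-- Inversions and Demazure products

sumTo : ℕ → (ℕ → ℕ) → ℕ
sumTo zero    h = 0
sumTo (suc n) h = sumTo n h + h (suc n)

sum-map-range1 : ∀ n h → sum (map h (range1 n)) ≡ sumTo n h
sum-map-range1 zero    h = refl
sum-map-range1 (suc n) h
  rewrite map-++ h (range1 n) (suc n ∷ []) | sum-++ (map h (range1 n)) (h (suc n) ∷ [])
        | sum-map-range1 n h | +-identityʳ (h (suc n))
  = refl

sum-concatMap : ∀ (g : ℕ → List ℕ) xs → sum (concatMap g xs) ≡ sum (map (sum ∘ g) xs)
sum-concatMap g []       = refl
sum-concatMap g (x ∷ xs) rewrite sum-++ (g x) (concatMap g xs) | sum-concatMap g xs = refl

sumTo-cong : ∀ n {h h′ : ℕ → ℕ} → (∀ a → 1 ≤ a → a ≤ n → h a ≡ h′ a) → sumTo n h ≡ sumTo n h′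
sumTo-cong zero    h≡h′ = refl
sumTo-cong (suc n) h≡h′ =
  cong₂ _+_ (sumTo-cong n (λ a 1≤a a≤n → h≡h′ a 1≤a (m≤n⇒m≤1+n a≤n)))
            (h≡h′ (suc n) (s≤s z≤n) ≤-refl)

sumTo-+ : ∀ n (h h′ : ℕ → ℕ) → sumTo n (λ a → h a + h′ a) ≡ sumTo n h + sumTo n h′
sumTo-+ zero    h h′ = refl
sumTo-+ (suc n) h h′ rewrite sumTo-+ n h h′ = interchange (sumTo n h) (sumTo n h′) (h (suc n)) (h′ (suc n))

sumTo-zero : ∀ n → sumTo n (λ _ → 0) ≡ 0
sumTo-zero zero    = refl
sumTo-zero (suc n) rewrite sumTo-zero n = refl

indicator : ℕ → ℕ → ℕ → ℕ
indicator j v a = if a ≡ᵇ j then v else 0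

sumTo-indicator : ∀ n {j} v → 1 ≤ j → j ≤ n → sumTo n (indicator j v) ≡ v
sumTo-indicator zero    v 1≤j j≤0 = ⊥-elim (<⇒≱ 1≤j j≤0)
sumTo-indicator (suc n) {j} v 1≤j j≤1+n with suc n ≟ j
... | yes refl rewrite ≡ᵇ-refl (suc n) = cong (_+ v) (trans (sumTo-cong n vanishes) (sumTo-zero n))
  where
  vanishes : ∀ a → 1 ≤ a → a ≤ n → indicator (suc n) v a ≡ 0
  vanishes a _ a≤n rewrite ≢⇒≡ᵇ-false (<⇒≢ (s≤s a≤n)) = refl
... | no 1+n≢j
  rewrite ≢⇒≡ᵇ-false 1+n≢j | sumTo-indicator n v 1≤j (≤-pred (≤∧≢⇒< j≤1+n (≢-sym 1+n≢j)))
  = +-identityʳ v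

sumTo-∘s : ∀ n k h → 1 ≤ k → suc k ≤ n → sumTo n (h ∘ s k) ≡ sumTo n h
sumTo-∘s zero    k h 1≤k 1+k≤0 = ⊥-elim (<⇒≱ 1+k≤0 z≤n)
sumTo-∘s (suc n) k h 1≤k 1+k≤1+n with suc k ≟ suc n
sumTo-∘s (suc .(suc k)) (suc k) h 1≤k 1+k≤1+n | yes refl
  rewrite s-at-suc (suc k) | s-at (suc k)
  = trans (cong (λ t → t + h (suc (suc k)) + h (suc k)) (sumTo-cong k s-fixes))
          (xy∙z≈xz∙y (sumTo k h) (h (suc (suc k))) (h (suc k)))
  where
  s-fixes : ∀ a → 1 ≤ a → a ≤ k → h (s (suc k) a) ≡ h a
  s-fixes a _ a≤k = cong h (s-other (suc k) (<⇒≢ (s≤s a≤k)) (<⇒≢ (m<n⇒m<1+n (s≤s a≤k))))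
... | no 1+k≢1+n
  rewrite sumTo-∘s n k h 1≤k (≤-pred (≤∧≢⇒< 1+k≤1+n 1+k≢1+n))
        | s-other k (>⇒≢ (<-trans (n<1+n k) (≤∧≢⇒< 1+k≤1+n 1+k≢1+n))) (≢-sym 1+k≢1+n)
  = refl

sumTo² : ℕ → (ℕ → ℕ → ℕ) → ℕ
sumTo² N G = sumTo N (λ a → sumTo N (G a))

sumTo²-cong : ∀ N {G H : ℕ → ℕ → ℕ} → (∀ a b → G a b ≡ H a b) → sumTo² N G ≡ sumTo² N H
sumTo²-cong N G≡H = sumTo-cong N (λ a _ _ → sumTo-cong N (λ b _ _ → G≡H a b))

sumTo²-+ : ∀ N G H → sumTo² N (λ a b → G a b + H a b) ≡ sumTo² N G + sumTo² N H
sumTo²-+ N G H =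
  trans (sumTo-cong N (λ a _ _ → sumTo-+ N (G a) (H a))) (sumTo-+ N (λ a → sumTo N (G a)) (λ a → sumTo N (H a)))

sumTo²-∘s : ∀ N k G → 1 ≤ k → suc k ≤ N → sumTo² N (λ a b → G (s k a) (s k b)) ≡ sumTo² N G
sumTo²-∘s N k G 1≤k 1+k≤N =
  trans (sumTo-cong N (λ a _ _ → sumTo-∘s N k (G (s k a)) 1≤k 1+k≤N))
        (sumTo-∘s N k (λ a → sumTo N (G a)) 1≤k 1+k≤N)

indicator² : ℕ → ℕ → ℕ → ℕ → ℕ → ℕ
indicator² j₁ j₂ v a b = if a ≡ᵇ j₁ then indicator j₂ v b else 0

sumTo²-indicator² : ∀ N {j₁ j₂} v → 1 ≤ j₁ → j₁ ≤ N → 1 ≤ j₂ → j₂ ≤ N →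
  sumTo² N (indicator² j₁ j₂ v) ≡ v
sumTo²-indicator² N {j₁} {j₂} v 1≤j₁ j₁≤N 1≤j₂ j₂≤N =
  trans (sumTo-cong N row) (sumTo-indicator N v 1≤j₁ j₁≤N)
  where
  row : ∀ a → 1 ≤ a → a ≤ N → sumTo N (indicator² j₁ j₂ v a) ≡ indicator j₁ v a
  row a _ _ with a ≡ᵇ j₁
  ... | true  = sumTo-indicator N v 1≤j₂ j₂≤N
  ... | false = sumTo-zero N

inversion : (ℕ → ℕ) → ℕ → ℕ → ℕ
inversion f a b = b2n ((a <ᵇ b) ∧ (f b <ᵇ f a))

invs≡sumTo² : ∀ N f → invs N f ≡ sumTo² N (inversion f)
invs≡sumTo² N f = begin
  invs N f
    ≡⟨ sum-concatMap (λ a → map (inversion f a) (range1 N)) (range1 N) ⟩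
  sum (map (λ a → sum (map (inversion f a) (range1 N))) (range1 N))
    ≡⟨ cong sum (map-cong (λ a → sum-map-range1 N (inversion f a)) (range1 N)) ⟩
  sum (map (λ a → sumTo N (inversion f a)) (range1 N))
    ≡⟨ sum-map-range1 N (λ a → sumTo N (inversion f a)) ⟩
  sumTo² N (inversion f)
    ∎
  where open ≡-Reasoning

<ᵇ-skip-left : ∀ k b → b ≢ suc k → (k <ᵇ b) ≡ (suc k <ᵇ b)
<ᵇ-skip-left zero    zero          _     = refl
<ᵇ-skip-left zero    (suc zero)    b≢1   = ⊥-elim (b≢1 refl)
<ᵇ-skip-left zero    (suc (suc b)) _     = refl
<ᵇ-skip-left (suc k) zero          _     = refl
<ᵇ-skip-left (suc k) (suc b)       b≢2+k = <ᵇ-skip-left k b (b≢2+k ∘ cong suc)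

<ᵇ-skip-right : ∀ k a → a ≢ k → (a <ᵇ suc k) ≡ (a <ᵇ k)
<ᵇ-skip-right zero    zero    a≢0   = ⊥-elim (a≢0 refl)
<ᵇ-skip-right zero    (suc a) _     = refl
<ᵇ-skip-right (suc k) zero    _     = refl
<ᵇ-skip-right (suc k) (suc a) a≢1+k = <ᵇ-skip-right k a (a≢1+k ∘ cong suc)

-- Reindexing by s_k preserves a < b except on the pairs (k, k + 1) and (k + 1, k).
inversion-∘s : ∀ f k a b →
  inversion (f ∘ s k) a b + indicator² (suc k) k (b2n (f (suc k) <ᵇ f k)) a b
  ≡ inversion f (s k a) (s k b) + indicator² k (suc k) (b2n (f k <ᵇ f (suc k))) a b
inversion-∘s f k a b with a ≟ k | a ≟ suc k | b ≟ k | b ≟ suc k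
... | yes refl | _ | yes refl | _
  rewrite s-at a | <ᵇ-irrefl a | ≢⇒≡ᵇ-false (n≢1+n a) | ≡ᵇ-refl a = refl
... | yes refl | _ | no _ | yes refl
  rewrite s-at a | s-at-suc a | n<ᵇ1+n a | 1+n<ᵇn a | ≢⇒≡ᵇ-false (n≢1+n a) | ≡ᵇ-refl a
  = +-identityʳ _
... | yes refl | _ | no b≢k | no b≢1+k
  rewrite s-at a | s-other a b≢k b≢1+k | ≢⇒≡ᵇ-false (n≢1+n a) | ≡ᵇ-refl a | ≢⇒≡ᵇ-false b≢1+k
        | <ᵇ-skip-left a b b≢1+k
  = refl
... | no _ | yes refl | yes refl | _
  rewrite s-at b | s-at-suc b | n<ᵇ1+n b | 1+n<ᵇn b | ≢⇒≡ᵇ-false (1+n≢n {b}) | ≡ᵇ-refl b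
  = sym (+-identityʳ _)
... | no _ | yes refl | no _ | yes refl
  rewrite s-at-suc k | <ᵇ-irrefl (suc k) | ≢⇒≡ᵇ-false (1+n≢n {k}) | ≡ᵇ-refl (suc k) = refl
... | no _ | yes refl | no b≢k | no b≢1+k
  rewrite s-at-suc k | s-other k b≢k b≢1+k | ≢⇒≡ᵇ-false (1+n≢n {k}) | ≡ᵇ-refl (suc k) | ≢⇒≡ᵇ-false b≢k
        | <ᵇ-skip-left k b b≢1+k
  = refl
... | no a≢k | no a≢1+k | yes refl | _
  rewrite s-at b | s-other b a≢k a≢1+k | ≢⇒≡ᵇ-false a≢k | ≢⇒≡ᵇ-false a≢1+k | <ᵇ-skip-right b a a≢k
  = refl
... | no a≢k | no a≢1+k | no _ | yes refl
  rewrite s-at-suc k | s-other k a≢k a≢1+k | ≢⇒≡ᵇ-false a≢k | ≢⇒≡ᵇ-false a≢1+k | <ᵇ-skip-right k a a≢k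
  = refl
... | no a≢k | no a≢1+k | no b≢k | no b≢1+k
  rewrite s-other k a≢k a≢1+k | s-other k b≢k b≢1+k | ≢⇒≡ᵇ-false a≢k | ≢⇒≡ᵇ-false a≢1+k = refl

invs-∘s : ∀ N f k → 1 ≤ k → suc k ≤ N →
  invs N (f ∘ s k) + b2n (f (suc k) <ᵇ f k) ≡ invs N f + b2n (f k <ᵇ f (suc k))
invs-∘s N f k 1≤k 1+k≤N = begin
  invs N (f ∘ s k) + b2n (f (suc k) <ᵇ f k)
    ≡⟨ cong₂ _+_ (invs≡sumTo² N (f ∘ s k)) (sym (sumTo²-indicator² N _ (s≤s z≤n) 1+k≤N 1≤k k≤N)) ⟩
  sumTo² N (inversion (f ∘ s k)) + sumTo² N (indicator² (suc k) k _)
    ≡⟨ sumTo²-+ N (inversion (f ∘ s k)) (indicator² (suc k) k _) ⟨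
  sumTo² N (λ a b → inversion (f ∘ s k) a b + indicator² (suc k) k _ a b)
    ≡⟨ sumTo²-cong N (inversion-∘s f k) ⟩
  sumTo² N (λ a b → inversion f (s k a) (s k b) + indicator² k (suc k) _ a b)
    ≡⟨ sumTo²-+ N (λ a b → inversion f (s k a) (s k b)) (indicator² k (suc k) _) ⟩
  sumTo² N (λ a b → inversion f (s k a) (s k b)) + sumTo² N (indicator² k (suc k) _)
    ≡⟨ cong₂ _+_ (sumTo²-∘s N k (inversion f) 1≤k 1+k≤N)
                 (sumTo²-indicator² N _ 1≤k k≤N (s≤s z≤n) 1+k≤N) ⟩
  sumTo² N (inversion f) + b2n (f k <ᵇ f (suc k))
    ≡⟨ cong (_+ b2n (f k <ᵇ f (suc k))) (invs≡sumTo² N f) ⟨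
  invs N f + b2n (f k <ᵇ f (suc k))
    ∎
  where
  open ≡-Reasoning
  k≤N : k ≤ N
  k≤N = ≤-trans (n≤1+n k) 1+k≤N

invs-∘s-< : ∀ N u a → 1 ≤ a → suc a ≤ N → u a < u (suc a) → invs N (u ∘ s a) ≡ suc (invs N u)
invs-∘s-< N u a 1≤a 1+a≤N lt = begin
  invs N (u ∘ s a)                          ≡⟨ +-identityʳ _ ⟨
  invs N (u ∘ s a) + 0                      ≡⟨ cong (invs N (u ∘ s a) +_) (cong b2n (≥⇒<ᵇ-false (<⇒≤ lt))) ⟨
  invs N (u ∘ s a) + b2n (u (suc a) <ᵇ u a) ≡⟨ invs-∘s N u a 1≤a 1+a≤N ⟩
  invs N u + b2n (u a <ᵇ u (suc a))         ≡⟨ cong (invs N u +_) (cong b2n (<⇒<ᵇ-true lt)) ⟩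
  invs N u + 1                              ≡⟨ +-comm (invs N u) 1 ⟩
  suc (invs N u)                            ∎
  where open ≡-Reasoning

invs-∘s-≥ : ∀ N u a → 1 ≤ a → suc a ≤ N → u (suc a) ≤ u a → invs N (u ∘ s a) ≤ invs N u
invs-∘s-≥ N u a 1≤a 1+a≤N ge = begin
  invs N (u ∘ s a)                          ≤⟨ m≤m+n _ _ ⟩
  invs N (u ∘ s a) + b2n (u (suc a) <ᵇ u a) ≡⟨ invs-∘s N u a 1≤a 1+a≤N ⟩
  invs N u + b2n (u a <ᵇ u (suc a))         ≡⟨ cong (λ t → invs N u + b2n t) (≥⇒<ᵇ-false ge) ⟩
  invs N u + 0                              ≡⟨ +-identityʳ _ ⟩
  invs N u                                  ∎
  where open ≤-Reasoning

demStep≗sortAt : ∀ N u a → 1 ≤ a → suc a ≤ N → demStep N u a ≗ sortAt u a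
demStep≗sortAt N u a 1≤a 1+a≤N x with u a <? u (suc a)
... | yes lt rewrite invs-∘s-< N u a 1≤a 1+a≤N lt | ≡ᵇ-refl (invs N u) = sym (sortAt-< u a lt x)
... | no ≮ rewrite ≢⇒≡ᵇ-false (<⇒≢ (s≤s (invs-∘s-≥ N u a 1≤a 1+a≤N (≮⇒≥ ≮))))
  = sym (sortAt-≥ u a (≮⇒≥ ≮) x)

foldl-demStep≗act : ∀ N w → All (λ a → 1 ≤ a × suc a ≤ N) w →
  ∀ {u v} → u ≗ v → foldl (demStep N) u w ≗ act v w
foldl-demStep≗act N []      []                     u≗v = u≗v
foldl-demStep≗act N (a ∷ w) ((1≤a , 1+a≤N) ∷ inRange) u≗v =
  foldl-demStep≗act N w inRange (λ x → trans (demStep≗sortAt N _ a 1≤a 1+a≤N x) (sortAt-cong u≗v a x))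

maxList-upperBound : ∀ w → All (_≤ maxList w) w
maxList-upperBound []      = []
maxList-upperBound (a ∷ w) =
  m≤m⊔n a (maxList w) ∷ All.map (λ le → ≤-trans le (m≤n⊔m a (maxList w))) (maxList-upperBound w)

demazure≗act : ∀ w → All (1 ≤_) w → demazure w ≗ act id w
demazure≗act w positive =
  foldl-demStep≗act (suc (maxList w)) w
    (All.zipWith (λ (1≤a , a≤m) → 1≤a , s≤s a≤m) (positive , maxList-upperBound w)) (λ _ → refl)

-- Words of the rows of a pipe dream

crossLetter : (ℕ → Bool) → ℕ → ℕ → List ℕ
crossLetter row r c = if row c then (r + c) ∸ 1 ∷ [] else []

rowWord : (ℕ → Bool) → ℕ → ℕ → List ℕ
rowWord row r n = concatMap (crossLetter row r) (revRange1 n)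

crossLetter-suc : ∀ row r m → crossLetter row r (suc m) ≡ (if row (suc m) then r + m ∷ [] else [])
crossLetter-suc row r m rewrite +-suc r m = refl

crossLetter-true : ∀ {row} r m → row (suc m) ≡ true → crossLetter row r (suc m) ≡ [ r + m ]
crossLetter-true {row} r m cross rewrite crossLetter-suc row r m | cross = refl

crossLetter-false : ∀ {row} r c → row c ≡ false → crossLetter row r c ≡ []
crossLetter-false r c empty rewrite empty = refl

rowWord-lower : ∀ row r n → All (r ≤_) (rowWord row r n)
rowWord-lower row r zero = []
rowWord-lower row r (suc n) rewrite crossLetter-suc row r n with row (suc n)
... | true  = m≤m+n r n ∷ rowWord-lower row r n
... | false = rowWord-lower row r n

rowWord-upper : ∀ row r n → All (_< r + n) (rowWord row r n)
rowWord-upper row r zero = []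
rowWord-upper row r (suc n) rewrite crossLetter-suc row r n | +-suc r n with row (suc n)
... | true  = ≤-refl ∷ All.map m<n⇒m<1+n (rowWord-upper row r n)
... | false = All.map m<n⇒m<1+n (rowWord-upper row r n)

columnWord : ℕ → (ℕ → Bool) → (ℕ → Bool) → ℕ → ℕ → List ℕ
columnWord i top bottom l zero    = []
columnWord i top bottom l (suc k) =
  crossLetter top i (suc (l + k)) ++ crossLetter bottom (suc i) (suc (l + k)) ++ columnWord i top bottom l k

-- The letter of (i + 1, c) commutes with the letters of row i left of c, which are at most i + c - 2.
rowWords≈columnWord : ∀ i top bottom n → rowWord top i n ++ rowWord bottom (suc i) n ≈ columnWord i top bottom 0 n
rowWords≈columnWord i top bottom zero    = ≈-refl
rowWords≈columnWord i top bottom (suc n) = begin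
  (topLetter ++ rowWord top i n) ++ (bottomLetter ++ rowWord bottom (suc i) n)
    ≡⟨ ++-assoc topLetter (rowWord top i n) _ ⟩
  topLetter ++ rowWord top i n ++ bottomLetter ++ rowWord bottom (suc i) n
    ≡⟨ cong (topLetter ++_) (++-assoc (rowWord top i n) bottomLetter _) ⟨
  topLetter ++ (rowWord top i n ++ bottomLetter) ++ rowWord bottom (suc i) n
    ≈⟨ ≈-++⁺ˡ topLetter (≈-++⁺ʳ _ (commute-++ (rowWord top i n) bottomLetter bottomDistant)) ⟩
  topLetter ++ (bottomLetter ++ rowWord top i n) ++ rowWord bottom (suc i) n
    ≡⟨ cong (topLetter ++_) (++-assoc bottomLetter (rowWord top i n) _) ⟩
  topLetter ++ bottomLetter ++ rowWord top i n ++ rowWord bottom (suc i) n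
    ≈⟨ ≈-++⁺ˡ topLetter (≈-++⁺ˡ bottomLetter (rowWords≈columnWord i top bottom n)) ⟩
  topLetter ++ bottomLetter ++ columnWord i top bottom 0 n
    ∎
  where
  open ≈-Reasoning
  topLetter bottomLetter : List ℕ
  topLetter    = crossLetter top i (suc n)
  bottomLetter = crossLetter bottom (suc i) (suc n)
  bottomDistant : All (λ y → All (Distant y) (rowWord top i n)) bottomLetter
  bottomDistant rewrite crossLetter-suc bottom (suc i) n with bottom (suc n)
  ... | false = []
  ... | true  = All.map (λ lt → inj₂ (s≤s lt)) (rowWord-upper top i n) ∷ []

columnWord-++ : ∀ i top bottom l k →
  columnWord i top bottom 0 (l + k) ≡ columnWord i top bottom l k ++ columnWord i top bottom 0 l
columnWord-++ i top bottom l zero rewrite +-identityʳ l = refl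
columnWord-++ i top bottom l (suc k) rewrite +-suc l k | columnWord-++ i top bottom l k =
  sym (trans (++-assoc topLetter _ rest) (cong (topLetter ++_) (++-assoc bottomLetter _ rest)))
  where
  topLetter bottomLetter rest : List ℕ
  topLetter    = crossLetter top i (suc (l + k))
  bottomLetter = crossLetter bottom (suc i) (suc (l + k))
  rest         = columnWord i top bottom 0 l

columnWord-cong : ∀ i {top bottom top′ bottom′} l k →
  (∀ c → l < c → c ≤ l + k → top c ≡ top′ c × bottom c ≡ bottom′ c) →
  columnWord i top bottom l k ≡ columnWord i top′ bottom′ l k
columnWord-cong i l zero    agree = refl
columnWord-cong i {top′ = top′} {bottom′} l (suc k) agree
  with agree (suc (l + k)) (s≤s (m≤m+n l k)) (≤-reflexive (sym (+-suc l k)))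
... | top≡ , bottom≡ rewrite top≡ | bottom≡ =
  cong (λ w → crossLetter top′ i (suc (l + k)) ++ crossLetter bottom′ (suc i) (suc (l + k)) ++ w)
       (columnWord-cong i l k (λ c l<c c≤l+k → agree c l<c (≤-trans c≤l+k (+-monoʳ-≤ l (n≤1+n k)))))

full : ℕ → Bool
full _ = true

-- Sliding a cross at the right end of a full top row to its left end, by braid moves,
-- exchanges the two rows of the block.
slide : ∀ i bottom l k → i + (l + k) ∷ columnWord i full bottom l k ≈ columnWord i bottom full l k ++ [ i + l ]
slide i bottom l zero rewrite +-identityʳ l = ≈-refl
slide i bottom l (suc k) rewrite +-suc l k | +-suc i (l + k) with bottom (suc (l + k))
... | true  = begin
  suc m ∷ m ∷ suc m ∷ columnWord i full bottom l k   ≈⟨ ≈-++⁺ʳ _ (braid m) ⟨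
  m ∷ suc m ∷ m ∷ columnWord i full bottom l k       ≈⟨ ≈-++⁺ˡ (m ∷ suc m ∷ []) (slide i bottom l k) ⟩
  m ∷ suc m ∷ columnWord i bottom full l k ++ [ i + l ] ∎
  where
  open ≈-Reasoning
  m : ℕ
  m = i + (l + k)
... | false = ≈-∷⁺ (suc (i + (l + k))) (slide i bottom l k)

blockWord : ℕ → PipeDream → ℕ → List ℕ
blockWord i E n = columnWord i (E i) (E (suc i)) 0 n

blockWord-extend : ∀ i {E E′} xs m k →
  (∀ c → m < c → c ≤ m + k → E i c ≡ E′ i c × E (suc i) c ≡ E′ (suc i) c) →
  blockWord i E m ≈ blockWord i E′ m ++ xs → blockWord i E (m + k) ≈ blockWord i E′ (m + k) ++ xs
blockWord-extend i {E} {E′} xs m k agree E≈E′xs = begin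
  blockWord i E (m + k)                         ≡⟨ columnWord-++ i _ _ m k ⟩
  right E ++ blockWord i E m                    ≈⟨ ≈-++⁺ˡ (right E) E≈E′xs ⟩
  right E ++ blockWord i E′ m ++ xs             ≡⟨ cong (_++ _) (columnWord-cong i m k agree) ⟩
  right E′ ++ blockWord i E′ m ++ xs            ≡⟨ ++-assoc (right E′) _ xs ⟨
  (right E′ ++ blockWord i E′ m) ++ xs          ≡⟨ cong (_++ xs) (columnWord-++ i _ _ m k) ⟨
  blockWord i E′ (m + k) ++ xs                  ∎
  where
  open ≈-Reasoning
  right : PipeDream → List ℕ
  right F = columnWord i (F i) (F (suc i)) m k

All-range1 : ∀ {P : ℕ → Set} n → (∀ r → 1 ≤ r → r ≤ n → P r) → All P (range1 n)
All-range1 zero    P[_] = []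
All-range1 (suc n) P[_] =
  ++⁺ (All-range1 n (λ r 1≤r r≤n → P[ r ] 1≤r (m≤n⇒m≤1+n r≤n))) (P[ suc n ] (s≤s z≤n) ≤-refl ∷ [])

range1-+ : ∀ m k → range1 (m + k) ≡ range1 m ++ map (m +_) (range1 k)
range1-+ m zero    rewrite +-identityʳ m = sym (++-identityʳ (range1 m))
range1-+ m (suc k) rewrite +-suc m k | range1-+ m k | map-++ (m +_) (range1 k) [ suc k ] | +-suc m k =
  ++-assoc (range1 m) (map (m +_) (range1 k)) [ suc (m + k) ]

concatMap-cong-local : ∀ {f g : ℕ → List ℕ} {xs} → All (λ x → f x ≡ g x) xs → concatMap f xs ≡ concatMap g xs
concatMap-cong-local f≡g = cong concat (map-cong-local f≡g)

concatMap-empty : ∀ {f : ℕ → List ℕ} {xs} → All (λ x → f x ≡ []) xs → concatMap f xs ≡ []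
concatMap-empty []               = refl
concatMap-empty (fx≡[] ∷ fxs≡[]) rewrite fx≡[] = concatMap-empty fxs≡[]

rowWord-cong : ∀ {row row′} r n → (∀ c → 1 ≤ c → c ≤ n → row c ≡ row′ c) →
  rowWord row r n ≡ rowWord row′ r n
rowWord-cong r zero    agree = refl
rowWord-cong r (suc n) agree =
  cong₂ _++_ (cong (λ b → if b then (r + suc n) ∸ 1 ∷ [] else []) (agree (suc n) (s≤s z≤n) ≤-refl))
             (rowWord-cong r n (λ c 1≤c c≤n → agree c 1≤c (m≤n⇒m≤1+n c≤n)))

rowWord-empty : ∀ {row} r n → (∀ c → row c ≡ false) → rowWord row r n ≡ []
rowWord-empty r zero    empty = refl
rowWord-empty r (suc n) empty rewrite empty (suc n) = rowWord-empty r n empty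

rowWord-pad : ∀ {row} r n k → (∀ c → n < c → row c ≡ false) → rowWord row r (n + k) ≡ rowWord row r n
rowWord-pad r n zero    empty rewrite +-identityʳ n = refl
rowWord-pad r n (suc k) empty rewrite +-suc n k | empty (suc (n + k)) (s≤s (m≤m+n n k)) = rowWord-pad r n k empty

-- Mitosis

firstFalse-true : ∀ f {j c} fuel → j ≤ c → c < firstFalse f j fuel → f c ≡ true
firstFalse-true f zero j≤c c<j = ⊥-elim (<⇒≱ c<j j≤c)
firstFalse-true f {j} {c} (suc fuel) j≤c c<ff with f j in fj
... | false = ⊥-elim (<⇒≱ c<ff j≤c)
... | true with j ≟ c
...   | yes refl = fj
...   | no j≢c   = firstFalse-true f fuel (≤∧≢⇒< j≤c j≢c) c<ff

firstFalse-bound : ∀ f j fuel → firstFalse f j fuel ≤ j + fuel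
firstFalse-bound f j zero = ≤-reflexive (sym (+-identityʳ j))
firstFalse-bound f j (suc fuel) with f j
... | false = m≤m+n j (suc fuel)
... | true  = ≤-trans (firstFalse-bound f (suc j) fuel) (≤-reflexive (sym (+-suc j fuel)))

FiniteIn-right : ∀ {D B} → FiniteIn D B → ∀ r c → B < c → D r c ≡ false
FiniteIn-right {D} finite r c B<c with D r c in cross
... | false = refl
... | true  = ⊥-elim (<⇒≱ B<c (proj₂ (proj₂ (finite r c cross))))

FiniteIn-below : ∀ {D B r} → FiniteIn D B → B < r → ∀ c → D r c ≡ false
FiniteIn-below {D} {r = r} finite B<r c with D r c in cross
... | false = refl
... | true  = ⊥-elim (<⇒≱ B<r (proj₂ (proj₁ (finite r c cross))))

at-≤ : ∀ (P : ℕ → Set) {m n} → m ≤ n → (∀ k → P (m + k)) → P n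
at-≤ P m≤n P[m+_] = subst P (m+[n∸m]≡n m≤n) (P[m+_] _)

word-positive : ∀ E n → All (1 ≤_) (word E n)
word-positive E n = concat⁺ (All-map⁺ (All-range1 n (λ r 1≤r _ → All.map (≤-trans 1≤r) (rowWord-lower (E r) r n))))

module Mitosis (D : PipeDream) (B i : ℕ) where

  nextRow : ℕ → Bool
  nextRow = D (suc i)

  start-full : ∀ {c} → 1 ≤ c → c < start D B i → D i c ≡ true
  start-full 1≤c = firstFalse-true (D i) (suc B) 1≤c

  inJ-sound : ∀ {c} → inJ D B i c ≡ true → 1 ≤ c × c < start D B i × nextRow c ≡ false
  inJ-sound {suc c} c∈J with suc c <ᵇ start D B i in lt | nextRow (suc c)
  inJ-sound {suc c} c∈J | true | false = s≤s z≤n , <ᵇ-true⇒< lt , refl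

  inJ-below-start : ∀ {c} → 1 ≤ c → c < start D B i → inJ D B i c ≡ not (nextRow c)
  inJ-below-start {suc c} _ c<start rewrite <⇒<ᵇ-true c<start = refl

  daughter : ℕ → PipeDream
  daughter = mitosisPD D B i

  daughter-row : ∀ p c →
    daughter p i c ≡ (if c ≡ᵇ p then false else (if inJ D B i c ∧ (c <ᵇ p) then false else D i c))
  daughter-row p c rewrite ≡ᵇ-refl i = refl

  daughter-nextRow : ∀ p c → daughter p (suc i) c ≡ (if inJ D B i c ∧ (c <ᵇ p) then true else nextRow c)
  daughter-nextRow p c rewrite ≢⇒≡ᵇ-false (1+n≢n {i}) | ≡ᵇ-refl i = refl

  daughter-otherRow : ∀ p {r} c → r ≢ i → r ≢ suc i → daughter p r c ≡ D r c
  daughter-otherRow p c r≢i r≢1+i rewrite ≢⇒≡ᵇ-false r≢i | ≢⇒≡ᵇ-false r≢1+i = refl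

  daughter-row-at : ∀ p → daughter p i p ≡ false
  daughter-row-at p rewrite daughter-row p p | ≡ᵇ-refl p = refl

  module _ {p} (p∈J : inJ D B i p ≡ true) where

    p<start : p < start D B i
    p<start = proj₁ (proj₂ (inJ-sound p∈J))

    nextRow-empty : nextRow p ≡ false
    nextRow-empty = proj₂ (proj₂ (inJ-sound p∈J))

    daughter-nextRow-at : daughter p (suc i) p ≡ false
    daughter-nextRow-at rewrite daughter-nextRow p p | <ᵇ-irrefl p | ∧-zeroʳ (inJ D B i p) = nextRow-empty

    daughter-right : ∀ c → p < c → daughter p i c ≡ D i c × daughter p (suc i) c ≡ nextRow c
    daughter-right c p<c
      rewrite daughter-row p c | daughter-nextRow p c | ≢⇒≡ᵇ-false (>⇒≢ p<c) | ≥⇒<ᵇ-false (<⇒≤ p<c)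
            | ∧-zeroʳ (inJ D B i c)
      = refl , refl

    -- Left of p the cross of row i moves down exactly where row i + 1 is empty, so the two rows
    -- (full, nextRow) become (nextRow, full).
    daughter-left : ∀ c → 1 ≤ c → c < p → daughter p i c ≡ nextRow c × daughter p (suc i) c ≡ true
    daughter-left c 1≤c c<p
      rewrite daughter-row p c | daughter-nextRow p c | ≢⇒≡ᵇ-false (<⇒≢ c<p) | <⇒<ᵇ-true c<p
            | inJ-below-start 1≤c (<-trans c<p p<start)
      with nextRow c
    ... | true  = start-full 1≤c (<-trans c<p p<start) , refl
    ... | false = refl , refl

  blockWord-daughter-left : ∀ {q} → inJ D B i (suc q) ≡ true →
    blockWord i (daughter (suc q)) (suc q) ≡ columnWord i nextRow full 0 q
  blockWord-daughter-left {q} p∈J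
    rewrite crossLetter-false {daughter (suc q) i} i (suc q) (daughter-row-at (suc q))
          | crossLetter-false {daughter (suc q) (suc i)} (suc i) (suc q) (daughter-nextRow-at p∈J)
    = columnWord-cong i 0 q (λ c 1≤c c≤q → daughter-left p∈J c 1≤c (s≤s c≤q))

  blockWord-daughter : ∀ {p} → inJ D B i p ≡ true → blockWord i D p ≈ blockWord i (daughter p) p ++ [ i ]
  blockWord-daughter {suc q} p∈J = begin
    blockWord i D (suc q)                            ≡⟨ D-block ⟩
    i + q ∷ columnWord i full nextRow 0 q            ≈⟨ slide i nextRow 0 q ⟩
    columnWord i nextRow full 0 q ++ [ i + 0 ]
      ≡⟨ cong₂ (λ w j → w ++ [ j ]) (blockWord-daughter-left p∈J) (sym (+-identityʳ i)) ⟨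
    blockWord i (daughter (suc q)) (suc q) ++ [ i ]  ∎
    where
    open ≈-Reasoning
    D-block : blockWord i D (suc q) ≡ i + q ∷ columnWord i full nextRow 0 q
    D-block rewrite crossLetter-true {D i} i q (start-full (s≤s z≤n) (p<start p∈J))
                  | crossLetter-false {nextRow} (suc i) (suc q) (nextRow-empty p∈J)
      = cong (i + q ∷_) (columnWord-cong i 0 q (λ c 1≤c c≤q →
          start-full 1≤c (<-trans (s≤s c≤q) (p<start p∈J)) , refl))

  module _ {q k} (p∈J : inJ D B i (suc q) ≡ true) (p′∈J : inJ D B i (suc (suc q + k)) ≡ true) where

    blockWord-earlier-daughter : blockWord i (daughter (suc q)) (suc (suc q + k))
      ≡ i + (suc q + k) ∷ columnWord i full nextRow (suc q) k ++ columnWord i nextRow full 0 q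
    blockWord-earlier-daughter
      rewrite crossLetter-true {daughter (suc q) i} i (suc q + k)
                (trans (proj₁ (daughter-right p∈J _ (s≤s (m≤m+n (suc q) k))))
                       (start-full (s≤s z≤n) (p<start p′∈J)))
            | crossLetter-false {daughter (suc q) (suc i)} (suc i) (suc (suc q + k))
                (trans (proj₂ (daughter-right p∈J _ (s≤s (m≤m+n (suc q) k)))) (nextRow-empty p′∈J))
            | columnWord-++ i (daughter (suc q) i) (daughter (suc q) (suc i)) (suc q) k
            | columnWord-cong i {top′ = full} {nextRow} (suc q) k (λ c p<c c≤p+k →
                trans (proj₁ (daughter-right p∈J c p<c))
                      (start-full (≤-trans (s≤s z≤n) p<c) (<-trans (s≤s c≤p+k) (p<start p′∈J)))
                , proj₂ (daughter-right p∈J c p<c))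
            | blockWord-daughter-left p∈J
      = refl

    blockWord-later-daughter : (columnWord i nextRow full (suc q) k ++ [ i + suc q ]) ++ columnWord i nextRow full 0 q
      ≡ blockWord i (daughter (suc (suc q + k))) (suc (suc q + k))
    blockWord-later-daughter
      rewrite crossLetter-false {daughter (suc (suc q + k)) i} i (suc (suc q + k)) (daughter-row-at (suc (suc q + k)))
            | crossLetter-false {daughter (suc (suc q + k)) (suc i)} (suc i) (suc (suc q + k)) (daughter-nextRow-at p′∈J)
            | columnWord-++ i (daughter (suc (suc q + k)) i) (daughter (suc (suc q + k)) (suc i)) (suc q) k
            | columnWord-cong i {top′ = nextRow} {full} (suc q) k (λ c p<c c≤p+k →
                daughter-left p′∈J c (≤-trans (s≤s z≤n) p<c) (s≤s c≤p+k))
            | crossLetter-false {daughter (suc (suc q + k)) i} i (suc q)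
                (trans (proj₁ (daughter-left p′∈J (suc q) (s≤s z≤n) (s≤s (m≤m+n (suc q) k)))) (nextRow-empty p∈J))
            | crossLetter-true {daughter (suc (suc q + k)) (suc i)} (suc i) q
                (proj₂ (daughter-left p′∈J (suc q) (s≤s z≤n) (s≤s (m≤m+n (suc q) k))))
            | columnWord-cong i {top′ = nextRow} {full} 0 q (λ c 1≤c c≤q →
                daughter-left p′∈J c 1≤c (<-trans (s≤s c≤q) (s≤s (m≤m+n (suc q) k))))
            | +-suc i q
      = ++-assoc (columnWord i nextRow full (suc q) k) [ suc (i + q) ] _

    blockWord-daughters : blockWord i (daughter (suc q)) (suc (suc q + k))
      ≈ blockWord i (daughter (suc (suc q + k))) (suc (suc q + k))
    blockWord-daughters = begin
      blockWord i (daughter (suc q)) (suc (suc q + k))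
        ≡⟨ blockWord-earlier-daughter ⟩
      i + (suc q + k) ∷ columnWord i full nextRow (suc q) k ++ columnWord i nextRow full 0 q
        ≈⟨ ≈-++⁺ʳ _ (slide i nextRow (suc q) k) ⟩
      (columnWord i nextRow full (suc q) k ++ [ i + suc q ]) ++ columnWord i nextRow full 0 q
        ≡⟨ blockWord-later-daughter ⟩
      blockWord i (daughter (suc (suc q + k))) (suc (suc q + k))
        ∎
      where open ≈-Reasoning

  B′ : ℕ
  B′ = B + suc i

  inJ-≤B′ : ∀ {p} → inJ D B i p ≡ true → p ≤ B′
  inJ-≤B′ p∈J = ≤-trans (≤-pred (≤-trans (p<start p∈J) (firstFalse-bound (D i) 1 (suc B))))
                        (≤-trans (s≤s (m≤m+n B i)) (≤-reflexive (sym (+-suc B i))))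

  blockWord-daughter-B′ : ∀ {p} → inJ D B i p ≡ true → blockWord i D B′ ≈ blockWord i (daughter p) B′ ++ [ i ]
  blockWord-daughter-B′ {p} p∈J =
    at-≤ (λ n → blockWord i D n ≈ blockWord i (daughter p) n ++ [ i ]) (inJ-≤B′ {p} p∈J) (λ k →
      blockWord-extend i {D} {daughter p} [ i ] p k (λ c p<c _ → ×-map sym sym (daughter-right {p} p∈J c p<c))
        (blockWord-daughter {p} p∈J))

  blockWord-daughters-B′-< : ∀ {p p′} → inJ D B i p ≡ true → inJ D B i p′ ≡ true → p < p′ →
    blockWord i (daughter p) B′ ≈ blockWord i (daughter p′) B′
  blockWord-daughters-B′-< {suc q} {p′} p∈J p′∈J p<p′ with m≤n⇒∃[o]m+o≡n p<p′
  ... | k , refl =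
    at-≤ (λ n → blockWord i (daughter (suc q)) n ≈ blockWord i (daughter p′) n) (inJ-≤B′ {p′} p′∈J) extended
    where
    open ≈-Reasoning
    agree : ∀ c → p′ < c →
      daughter (suc q) i c ≡ daughter p′ i c × daughter (suc q) (suc i) c ≡ daughter p′ (suc i) c
    agree c p′<c =
      ×-zip trans trans (daughter-right p∈J c (<-trans p<p′ p′<c)) (×-map sym sym (daughter-right p′∈J c p′<c))
    extended : ∀ k′ → blockWord i (daughter (suc q)) (p′ + k′) ≈ blockWord i (daughter p′) (p′ + k′)
    extended k′ = begin
      blockWord i (daughter (suc q)) (p′ + k′)
        ≈⟨ blockWord-extend i {daughter (suc q)} {daughter p′} [] p′ k′ (λ c p′<c _ → agree c p′<c)
             (≈-trans (blockWord-daughters p∈J p′∈J) (≈-reflexive (sym (++-identityʳ _)))) ⟩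
      blockWord i (daughter p′) (p′ + k′) ++ []
        ≡⟨ ++-identityʳ _ ⟩
      blockWord i (daughter p′) (p′ + k′)
        ∎

  blockWord-daughters-B′ : ∀ {p p′} → inJ D B i p ≡ true → inJ D B i p′ ≡ true →
    blockWord i (daughter p) B′ ≈ blockWord i (daughter p′) B′
  blockWord-daughters-B′ {p} {p′} p∈J p′∈J with <-cmp p p′
  ... | tri< p<p′ _ _ = blockWord-daughters-B′-< p∈J p′∈J p<p′
  ... | tri≈ _ refl _ = ≈-refl
  ... | tri> _ _ p′<p = ≈-sym (blockWord-daughters-B′-< p′∈J p∈J p′<p)

  rowWordOf : PipeDream → ℕ → List ℕ
  rowWordOf E r = rowWord (E r) r B′

  rowPair rowsAbove rowsBelow : PipeDream → List ℕ
  rowPair   E = rowWordOf E i ++ rowWordOf E (suc i)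
  rowsAbove E = concatMap (rowWordOf E) (range1 (pred i))
  rowsBelow E = concatMap (rowWordOf E) (map (suc i +_) (range1 B))

  word-split : 1 ≤ i → ∀ E → word E B′ ≡ rowsAbove E ++ rowPair E ++ rowsBelow E
  word-split 1≤i E = begin
    concatMap (rowWordOf E) (range1 (B + suc i))
      ≡⟨ cong (concatMap (rowWordOf E)) (trans (cong range1 (+-comm B (suc i))) (range1-+ (suc i) B)) ⟩
    concatMap (rowWordOf E) (range1 (suc i) ++ map (suc i +_) (range1 B))
      ≡⟨ cong (λ rows → concatMap (rowWordOf E) (rows ++ map (suc i +_) (range1 B))) (range1-suc-pred 1≤i) ⟩
    concatMap (rowWordOf E) (((range1 (pred i) ++ [ i ]) ++ [ suc i ]) ++ map (suc i +_) (range1 B))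
      ≡⟨ concatMap-rows (range1 (pred i)) ⟩
    rowsAbove E ++ rowPair E ++ rowsBelow E
      ∎
    where
    open ≡-Reasoning
    range1-suc-pred : ∀ {n} → 1 ≤ n → range1 (suc n) ≡ (range1 (pred n) ++ [ n ]) ++ [ suc n ]
    range1-suc-pred {suc n} _ = refl
    concatMap-rows : ∀ above → concatMap (rowWordOf E) (((above ++ [ i ]) ++ [ suc i ]) ++ map (suc i +_) (range1 B))
                               ≡ concatMap (rowWordOf E) above ++ rowPair E ++ rowsBelow E
    concatMap-rows above
      rewrite concatMap-++ (rowWordOf E) ((above ++ [ i ]) ++ [ suc i ]) (map (suc i +_) (range1 B))
            | concatMap-++ (rowWordOf E) (above ++ [ i ]) [ suc i ]
            | concatMap-++ (rowWordOf E) above [ i ]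
            | ++-identityʳ (rowWordOf E i) | ++-identityʳ (rowWordOf E (suc i))
            | ++-assoc (concatMap (rowWordOf E) above) (rowWordOf E i) (rowWordOf E (suc i))
            | ++-assoc (concatMap (rowWordOf E) above) (rowPair E) (rowsBelow E)
      = refl

  rowsAbove-daughter : 1 ≤ i → ∀ p → rowsAbove (daughter p) ≡ rowsAbove D
  rowsAbove-daughter 1≤i p = concatMap-cong-local (All-range1 (pred i) (λ r _ r≤i-1 →
    rowWord-cong r B′ (λ c _ _ → daughter-otherRow p c (<⇒≢ (r<i r≤i-1)) (<⇒≢ (m<n⇒m<1+n (r<i r≤i-1))))))
    where
    r<i : ∀ {r} → r ≤ pred i → r < i
    r<i r≤i-1 = ≤-trans (s≤s r≤i-1) (≤-reflexive (suc-pred i {{>-nonZero 1≤i}}))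

  rowsBelow-daughter : ∀ p → rowsBelow (daughter p) ≡ rowsBelow D
  rowsBelow-daughter p = concatMap-cong-local (All-map⁺ (All-range1 B (λ j 1≤j _ →
    rowWord-cong (suc i + j) B′ (λ c _ _ →
      daughter-otherRow p c (>⇒≢ (<-trans (n<1+n i) (m<m+n (suc i) 1≤j))) (>⇒≢ (m<m+n (suc i) 1≤j))))))

  rowsBelow-distant : ∀ E → All (Distant i) (rowsBelow E)
  rowsBelow-distant E = concat⁺ (All-map⁺ (All-map⁺ (All-range1 B (λ j 1≤j _ →
    All.map (λ 1+i+j≤a → inj₁ (<-≤-trans (m<m+n (suc i) 1≤j) 1+i+j≤a))
            (rowWord-lower (E (suc i + j)) (suc i + j) B′)))))

  rowPair-daughter : ∀ {p} → inJ D B i p ≡ true → rowPair D ≈ rowPair (daughter p) ++ [ i ]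
  rowPair-daughter {p} p∈J = begin
    rowPair D
      ≈⟨ rowWords≈columnWord i (D i) nextRow B′ ⟩
    blockWord i D B′
      ≈⟨ blockWord-daughter-B′ p∈J ⟩
    blockWord i (daughter p) B′ ++ [ i ]
      ≈⟨ ≈-++⁺ʳ [ i ] (rowWords≈columnWord i (daughter p i) (daughter p (suc i)) B′) ⟨
    rowPair (daughter p) ++ [ i ]
      ∎
    where open ≈-Reasoning

  word-daughter : 1 ≤ i → ∀ {p} → inJ D B i p ≡ true → word D B′ ≈ word (daughter p) B′ ++ [ i ]
  word-daughter 1≤i {p} p∈J = begin
    word D B′
      ≡⟨ word-split 1≤i D ⟩
    above ++ rowPair D ++ below
      ≈⟨ ≈-++⁺ˡ above (≈-++⁺ʳ below (rowPair-daughter p∈J)) ⟩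
    above ++ (rowPair Dp ++ [ i ]) ++ below
      ≡⟨ cong (above ++_) (++-assoc (rowPair Dp) [ i ] below) ⟩
    above ++ rowPair Dp ++ i ∷ below
      ≈⟨ ≈-++⁺ˡ above (≈-++⁺ˡ (rowPair Dp) (commute-∷ʳ i below (rowsBelow-distant D))) ⟨
    above ++ rowPair Dp ++ below ++ [ i ]
      ≡⟨ reassociate ⟩
    (above ++ rowPair Dp ++ below) ++ [ i ]
      ≡⟨ cong (_++ [ i ]) daughter-split ⟨
    word Dp B′ ++ [ i ]
      ∎
    where
    open ≈-Reasoning
    Dp : PipeDream
    Dp = daughter p
    above below : List ℕ
    above = rowsAbove D
    below = rowsBelow D
    reassociate : above ++ rowPair Dp ++ below ++ [ i ] ≡ (above ++ rowPair Dp ++ below) ++ [ i ]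
    reassociate = sym (trans (++-assoc above _ [ i ]) (cong (above ++_) (++-assoc (rowPair Dp) below [ i ])))
    daughter-split : word Dp B′ ≡ above ++ rowPair Dp ++ below
    daughter-split rewrite word-split 1≤i Dp | rowsAbove-daughter 1≤i p | rowsBelow-daughter p = refl

  word-daughters : 1 ≤ i → ∀ {p p′} → inJ D B i p ≡ true → inJ D B i p′ ≡ true →
    word (daughter p) B′ ≈ word (daughter p′) B′
  word-daughters 1≤i {p} {p′} p∈J p′∈J
    rewrite word-split 1≤i (daughter p) | word-split 1≤i (daughter p′)
          | rowsAbove-daughter 1≤i p | rowsAbove-daughter 1≤i p′ | rowsBelow-daughter p | rowsBelow-daughter p′
    = ≈-++⁺ˡ (rowsAbove D) (≈-++⁺ʳ (rowsBelow D) (begin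
        rowPair (daughter p)          ≈⟨ rowWords≈columnWord i (daughter p i) (daughter p (suc i)) B′ ⟩
        blockWord i (daughter p) B′   ≈⟨ blockWord-daughters-B′ p∈J p′∈J ⟩
        blockWord i (daughter p′) B′  ≈⟨ rowWords≈columnWord i (daughter p′ i) (daughter p′ (suc i)) B′ ⟨
        rowPair (daughter p′)         ∎))
    where open ≈-Reasoning

  word-pad : FiniteIn D B → word D B′ ≡ word D B
  word-pad finite = begin
    concatMap (rowWordOf D) (range1 (B + suc i))
      ≡⟨ cong (concatMap (rowWordOf D)) (range1-+ B (suc i)) ⟩
    concatMap (rowWordOf D) (range1 B ++ map (B +_) (range1 (suc i)))
      ≡⟨ concatMap-++ (rowWordOf D) (range1 B) _ ⟩
    concatMap (rowWordOf D) (range1 B) ++ concatMap (rowWordOf D) (map (B +_) (range1 (suc i)))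
      ≡⟨ cong₂ _++_ inside outside ⟩
    word D B ++ []
      ≡⟨ ++-identityʳ _ ⟩
    word D B
      ∎
    where
    open ≡-Reasoning
    inside : concatMap (rowWordOf D) (range1 B) ≡ word D B
    inside = concatMap-cong-local (All-range1 B (λ r _ _ → rowWord-pad r B (suc i) (FiniteIn-right finite r)))
    outside : concatMap (rowWordOf D) (map (B +_) (range1 (suc i))) ≡ []
    outside = concatMap-empty (All-map⁺ (All-range1 (suc i) (λ j 1≤j _ →
                rowWord-empty (B + j) B′ (FiniteIn-below finite (m<m+n B 1≤j)))))

theorem2p3 : (w : Perm) (i : ℕ) → 1 ≤ i
    → invs (bound w + suc i) (λ x → fun w (s i x)) + 1 ≡ invs (bound w + suc i) (fun w)
    → (D : PipeDream) (B : ℕ) → FiniteIn D B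
    → InP D B (fun w)
    → ∃ (λ p → inJ D B i p ≡ true)
    → (∀ p → inJ D B i p ≡ true → InP (mitosisPD D B i p) (B + suc i) (λ x → fun w (s i x)))
      ⊎ (∀ p → inJ D B i p ≡ true → InP (mitosisPD D B i p) (B + suc i) (fun w))
theorem2p3 w i 1≤i _ D B finite D∈P (p₀ , p₀∈J) =
  Sum.map (λ v≗w∘sᵢ p p∈J x → trans (daughter≗v p∈J x) (v≗w∘sᵢ x))
          (λ v≗w p p∈J x → trans (daughter≗v p∈J x) (v≗w x))
          (sortAt-preimage i w≗v⋆sᵢ)
  where
  open Mitosis D B i
  v : ℕ → ℕ
  v = act id (word (daughter p₀) B′)
  w≗v⋆sᵢ : fun w ≗ sortAt v i
  w≗v⋆sᵢ x = begin
    fun w x                                   ≡⟨ D∈P x ⟨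
    demazure (word D B) x                     ≡⟨ demazure≗act (word D B) (word-positive D B) x ⟩
    act id (word D B) x                       ≡⟨ cong (λ u → act id u x) (word-pad finite) ⟨
    act id (word D B′) x                      ≡⟨ act-≗ (word-daughter 1≤i p₀∈J) id x ⟩
    act id (word (daughter p₀) B′ ++ [ i ]) x ≡⟨ act-++ id (word (daughter p₀) B′) [ i ] x ⟩
    sortAt v i x                              ∎
    where open ≡-Reasoning
  daughter≗v : ∀ {p} → inJ D B i p ≡ true → demazure (word (daughter p) B′) ≗ v
  daughter≗v {p} p∈J x = trans (demazure≗act _ (word-positive (daughter p) B′) x)
                               (act-≗ (word-daughters 1≤i p∈J p₀∈J) id x)
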